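{- Let $T$ be a tree with diameter $d\geq 1$ and let $P=u_0u_1\cdots u_d$ be a diametrical path of $T$. Let $A=A(T,P)$ be a maximal set of pendant vertices of $T$ satisfying: (1) $u_0,u_d\in A$; (2) every vertex of $A$ has distance exactly $\lfloor d/2\rfloor$ to $C(T)$; (3) the paths $P_w$, $w\in A$, are pairwise edge-disjoint, where $P_w$ is a shortest path from $w$ to $C(T)$. Then $2\leq |A|\leq |L(T)|$ and $d_T(A)=Sd_{|A|}(T)$.
   Context: $L(T)$ denotes the set of pendant vertices (vertices of degree $1$) of $T$. The eccentricity of a vertex is the maximum distance from it to another vertex; the radius is the minimum eccentricity; $C(T)$ is the set of central vertices (vertices of minimum eccentricity); the distance from a vertex $v$ to a vertex set $C$ is $\min\{d_T(v,u):u\in C\}$. A diametrical path is a shortest path between two vertices at distance equal to the diameter. For $S\subseteq V(T)$, the Steiner distance $d_T(S)$ is the minimum number of edges of a subtree of $T$ containing $S$. For $p\geq 2$ with $|V(T)|\geq p$, $Sd_p(T)$ is the maximum of $d_T(S)$ over all $p$-subsets $S\subseteq V(T)$. -}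

module Defs where

open import Data.Nat using (ℕ; zero; suc; _≤_; _/_; _<ᵇ_)
open import Data.Bool using (Bool; true; false; _∧_)
open import Data.Fin using (Fin; toℕ)
open import Data.Fin.Subset using (Subset; _∈_; _∉_; _⊆_; ∣_∣; Nonempty)
open import Data.Vec using (tabulate; lookup; sum)
open import Data.List using (List; []; _∷_)
open import Data.List.Relation.Unary.Unique.Propositional using (Unique)
open import Data.Product using (Σ; ∃; ∃-syntax; _×_; _,_)
open import Data.Sum using (_⊎_)
open import Relation.Nullary using (¬_)
open import Relation.Binary.PropositionalEquality using (_≡_; _≢_)

module _ {n : ℕ} (E : Fin n → Fin n → Bool) where

  data Walk : Fin n → Fin n → ℕ → Set where
    stop : (u : Fin n) → Walk u u 0
    step : ∀ {u v w k} → E u v ≡ true → Walk v w k → Walk u w (suc k)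

  verts : ∀ {u v k} → Walk u v k → List (Fin n)
  verts (stop u) = u ∷ []
  verts (step {u} _ p) = u ∷ verts p

  IsPath : ∀ {u v k} → Walk u v k → Set
  IsPath p = Unique (verts p)

  data EdgeIn : ∀ {u v k} → Walk u v k → Fin n → Fin n → Set where
    here  : ∀ {u v w k} {e : E u v ≡ true} {p : Walk v w k} → EdgeIn (step e p) u v
    there : ∀ {u v w k x y} {e : E u v ≡ true} {p : Walk v w k} →
            EdgeIn p x y → EdgeIn (step e p) x y

  SharesEdge : ∀ {u v k u' v' k'} → Walk u v k → Walk u' v' k' → Set
  SharesEdge p q = ∃[ x ] ∃[ y ] (EdgeIn p x y × (EdgeIn q x y ⊎ EdgeIn q y x))

  -- a cycle u v ... u of length ≥ 3 whose vertices (first one omitted) are distinct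
  HasCycle : Set
  HasCycle = ∃[ u ] ∃[ v ] ∃[ k ] Σ (E u v ≡ true) λ _ →
               Σ (Walk v u (suc (suc k))) λ p → Unique (verts p)

  Acyclic : Set
  Acyclic = ¬ HasCycle

  ConnectedOn : Subset n → Set
  ConnectedOn W = ∀ u v → u ∈ W → v ∈ W → ∃[ k ] Walk u v k

  edgeCount : ℕ
  edgeCount = sum (tabulate λ u → ∣ tabulate (λ v → E u v ∧ (toℕ u <ᵇ toℕ v)) ∣)

record Graph (n : ℕ) : Set where
  field
    adj        : Fin n → Fin n → Bool
    adj-sym    : ∀ u v → adj u v ≡ adj v u
    adj-irrefl : ∀ u → adj u u ≡ false

record Tree (n : ℕ) : Set where
  field
    graph     : Graph n
  open Graph graph public
  field
    connected : ConnectedOn adj Data.Fin.Subset.⊤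
    acyclic   : Acyclic adj

module _ {n : ℕ} (T : Tree n) where
  open Tree T

  nbhd : Fin n → Subset n
  nbhd v = tabulate (adj v)

  degree : Fin n → ℕ
  degree v = ∣ nbhd v ∣

  L : Subset n
  L = tabulate λ v → degree v Data.Nat.≡ᵇ 1

  Dist : Fin n → Fin n → ℕ → Set
  Dist u v k = Walk adj u v k × (∀ k' → Walk adj u v k' → k ≤ k')

  Ecc : Fin n → ℕ → Set
  Ecc v e = (∀ u → ∃[ k ] (Dist v u k × k ≤ e)) × ∃[ u ] Dist v u e

  Central : Fin n → Set
  Central v = ∃[ e ] (Ecc v e × (∀ w e' → Ecc w e' → e ≤ e'))

  DistToCenter : Fin n → ℕ → Set
  DistToCenter v k = (∃[ c ] (Central c × Dist v c k)) ×
                     (∀ c k' → Central c → Dist v c k' → k ≤ k')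

  IsDiameter : ℕ → Set
  IsDiameter d = (∃[ u ] ∃[ v ] Dist u v d) × (∀ u v k → Dist u v k → k ≤ d)

  IsDiametricalPath : ∀ {u₀ u_d d} → Walk adj u₀ u_d d → Set
  IsDiametricalPath {u₀} {u_d} {d} P = IsDiameter d × IsPath adj P × Dist u₀ u_d d

  Admissible : ℕ → Fin n → Fin n → Subset n → Set
  Admissible d u₀ u_d B =
    B ⊆ L ×
    (u₀ ∈ B × u_d ∈ B) ×
    (∀ w → w ∈ B → DistToCenter w (d / 2)) ×
    (∀ w w' → w ∈ B → w' ∈ B → w ≢ w' →
      ∀ c c' k k' (p : Walk adj w c k) (q : Walk adj w' c' k') →
      Central c → Central c' → DistToCenter w k → DistToCenter w' k' →
      ¬ SharesEdge adj p q)

  MaximalAdmissible : ℕ → Fin n → Fin n → Subset n → Set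
  MaximalAdmissible d u₀ u_d A =
    Admissible d u₀ u_d A × (∀ B → A ⊆ B → Admissible d u₀ u_d B → B ⊆ A)

  record Subtree : Set where
    field
      W       : Subset n
      F       : Fin n → Fin n → Bool
      F-sym   : ∀ u v → F u v ≡ F v u
      F-adj   : ∀ u v → F u v ≡ true → adj u v ≡ true
      F-in    : ∀ u v → F u v ≡ true → u ∈ W × v ∈ W
      W-ne    : Nonempty W
      F-conn  : ConnectedOn F W
      F-acyc  : Acyclic F

  SteinerDist : Subset n → ℕ → Set
  SteinerDist S k =
    (∃[ H ] (S ⊆ Subtree.W H × edgeCount (Subtree.F H) ≡ k)) ×
    (∀ H → S ⊆ Subtree.W H → k ≤ edgeCount (Subtree.F H))

  Sd : ℕ → ℕ → Set
  Sd p k = (∃[ S ] (∣ S ∣ ≡ p × SteinerDist S k)) ×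
           (∀ S k' → ∣ S ∣ ≡ p → SteinerDist S k' → k' ≤ k)

module Submission where

-- Let r = ⌊d/2⌋ and let xy be the (r+1)-st edge of P. Every u₀–u_d walk uses xy, so every vertex is
-- within distance r of a hub: x, or also y when d is odd. The hubs are central, so each w ∈ A is at
-- distance exactly r from its nearest hub, and these hub paths are pairwise edge-disjoint. Their union,
-- together with xy when d is odd, is a subtree with (d mod 2) + |A|·r edges, and every subtree containing
-- A contains it: a walk from w ∈ A to another vertex of A, closed up through the hub paths, must use
-- each edge of the hub path of w since T has no cycles. The same union built for any other set of |A|
-- vertices has at most (d mod 2) + |A|·r edges, so d_T(A) = Sd_{|A|}(T).

open import Defs
open import Data.Bool using (Bool; true; false; _∧_; _∨_)
open import Data.Bool.Properties using (∨-zeroʳ; ∨-comm; ∧-comm; ∧-distribʳ-∨; T-≡) renaming (_≟_ to _≟ᵇ_)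
open import Data.Empty using (⊥; ⊥-elim)
open import Data.Fin as Fin using (Fin; toℕ)
open import Data.Fin.Properties using (_≟_; suc-injective; toℕ-injective; any?)
open import Data.Fin.Subset using (Subset; _∈_; _⊆_; ∣_∣; _∪_; _∩_; ⁅_⁆)
open import Data.Fin.Subset.Properties
  using (∈⊤; ⊥⊆; ⊆-antisym; Empty-unique; ∣⊥∣≡0; ∣⁅x⁆∣≡1; x∈⁅x⁆; x∈⁅y⁆⇒x≡y; x∈p∩q⁻; x∈p∪q⁻; p⊆q⇒∣p∣≤∣q∣)
open import Data.List using (List; []; _∷_; length; map)
open import Data.List.Membership.Propositional using () renaming (_∈_ to _∈ˡ_)
open import Data.List.Membership.Propositional.Properties using (∈-map⁺; ∈-map⁻)
open import Data.List.Properties using (length-map)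
open import Data.List.Relation.Unary.All as All using ([]; _∷_)
open import Data.List.Relation.Unary.All.Properties using (¬Any⇒All¬)
open import Data.List.Relation.Unary.AllPairs using ([]; _∷_)
open import Data.List.Relation.Unary.Any using (here; there)
open import Data.List.Relation.Unary.Unique.Propositional using (Unique)
open import Data.List.Relation.Unary.Unique.Propositional.Properties using (map⁺)
open import Data.Nat using (ℕ; zero; suc; _+_; _*_; _/_; _%_; _≤_; _<_; _<ᵇ_; z≤n; s≤s; s≤s⁻¹)
open import Data.Nat.DivMod using (m≡m%n+[m/n]*n; m%n<n)
open import Data.Nat.Properties hiding (suc-injective) renaming (_≟_ to _≟ℕ_)
open import Algebra.Properties.CommutativeSemigroup +-commutativeSemigroup using () renaming (interchange to +-interchange)
open import Data.Nat.Solver using (module +-*-Solver)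
open import Data.Product as Product using (Σ; ∃-syntax; _×_; _,_; proj₁; proj₂)
open import Data.Sum as Sum using (_⊎_; inj₁; inj₂)
open import Data.Vec using (tabulate; zipWith; sum; []) renaming (_∷_ to _∷ᵛ_; here to hereᵛ; there to thereᵛ)
open import Data.Vec.Properties using (lookup⇒[]=; []=⇒lookup; lookup∘tabulate; tabulate-cong)
open import Function using (_∘_; case_of_; Equivalence)
open import Relation.Binary.Definitions using (tri<; tri≈; tri>)
open import Relation.Binary.PropositionalEquality
open import Relation.Nullary using (¬_; Dec; yes; no; does)
open import Relation.Nullary.Decidable using (dec-true; map′; _×-dec_)

least : ∀ {P : ℕ → Set} → (∀ k → Dec (P k)) → ∀ {m} → P m → ∃[ k ] (P k × ∀ j → P j → k ≤ j)
least P? {zero} p0 = 0 , p0 , λ _ _ → z≤n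
least P? {suc m} pm with P? 0
... | yes p0 = 0 , p0 , λ _ _ → z≤n
... | no ¬p0 with least (P? ∘ suc) pm
...   | k , pk , k-least = suc k , pk , λ where
        zero    p0 → ⊥-elim (¬p0 p0)
        (suc j) pj → s≤s (k-least j pj)

∧-true⁻ : ∀ {x y} → x ∧ y ≡ true → x ≡ true × y ≡ true
∧-true⁻ {true} y≡true = refl , y≡true

∧-true⁺ : ∀ {x y} → x ≡ true → y ≡ true → x ∧ y ≡ true
∧-true⁺ refl refl = refl

∨-true⁻ : ∀ {x y} → x ∨ y ≡ true → x ≡ true ⊎ y ≡ true
∨-true⁻ {true}  _      = inj₁ refl
∨-true⁻ {false} y≡true = inj₂ y≡true

∨-trueˡ : ∀ {x y} → x ≡ true → x ∨ y ≡ true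
∨-trueˡ refl = refl

∨-trueʳ : ∀ {x y} → y ≡ true → x ∨ y ≡ true
∨-trueʳ {x} refl = ∨-zeroʳ x

∧-distribʳ-∧ : ∀ x y z → (y ∧ z) ∧ x ≡ (y ∧ x) ∧ (z ∧ x)
∧-distribʳ-∧ false false _     = refl
∧-distribʳ-∧ false true  false = refl
∧-distribʳ-∧ false true  true  = refl
∧-distribʳ-∧ true  false _     = refl
∧-distribʳ-∧ true  true  _     = refl

from-does : ∀ {A : Set} (a? : Dec A) → does a? ≡ true → A
from-does (yes a) _ = a

∈-tabulate⁺ : ∀ {m} {f : Fin m → Bool} {x} → f x ≡ true → x ∈ tabulate f
∈-tabulate⁺ {f = f} {x} fx = lookup⇒[]= x (tabulate f) (trans (lookup∘tabulate f x) fx)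

∈-tabulate⁻ : ∀ {m} {f : Fin m → Bool} {x} → x ∈ tabulate f → f x ≡ true
∈-tabulate⁻ {f = f} {x} x∈ = trans (sym (lookup∘tabulate f x)) ([]=⇒lookup x∈)

tabulate-zipWith : ∀ {m} (_∙_ : Bool → Bool → Bool) (f g : Fin m → Bool) →
                   tabulate (λ i → f i ∙ g i) ≡ zipWith _∙_ (tabulate f) (tabulate g)
tabulate-zipWith {zero}  _∙_ f g = refl
tabulate-zipWith {suc m} _∙_ f g =
  cong (f Fin.zero ∙ g Fin.zero ∷ᵛ_) (tabulate-zipWith _∙_ (f ∘ Fin.suc) (g ∘ Fin.suc))

∣tabulate∣-empty : ∀ {m} {f : Fin m → Bool} → (∀ i → f i ≢ true) → ∣ tabulate f ∣ ≡ 0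
∣tabulate∣-empty {m} {f} f≢true =
  trans (cong ∣_∣ (⊆-antisym (λ {i} i∈ → ⊥-elim (f≢true i (∈-tabulate⁻ {f = f} i∈))) ⊥⊆)) (∣⊥∣≡0 m)

∣p∪q∣+∣p∩q∣≡∣p∣+∣q∣ : ∀ {m} (p q : Subset m) → ∣ p ∪ q ∣ + ∣ p ∩ q ∣ ≡ ∣ p ∣ + ∣ q ∣
∣p∪q∣+∣p∩q∣≡∣p∣+∣q∣ []          []          = refl
∣p∪q∣+∣p∩q∣≡∣p∣+∣q∣ (true ∷ᵛ p)  (true ∷ᵛ q)  =
  cong suc (trans (+-suc ∣ p ∪ q ∣ _) (trans (cong suc (∣p∪q∣+∣p∩q∣≡∣p∣+∣q∣ p q)) (sym (+-suc ∣ p ∣ _))))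
∣p∪q∣+∣p∩q∣≡∣p∣+∣q∣ (true ∷ᵛ p)  (false ∷ᵛ q) = cong suc (∣p∪q∣+∣p∩q∣≡∣p∣+∣q∣ p q)
∣p∪q∣+∣p∩q∣≡∣p∣+∣q∣ (false ∷ᵛ p) (true ∷ᵛ q)  =
  trans (cong suc (∣p∪q∣+∣p∩q∣≡∣p∣+∣q∣ p q)) (sym (+-suc ∣ p ∣ _))
∣p∪q∣+∣p∩q∣≡∣p∣+∣q∣ (false ∷ᵛ p) (false ∷ᵛ q) = ∣p∪q∣+∣p∩q∣≡∣p∣+∣q∣ p q

sum-tabulate-+ : ∀ {m} (f g : Fin m → ℕ) →
                 sum (tabulate (λ i → f i + g i)) ≡ sum (tabulate f) + sum (tabulate g)
sum-tabulate-+ {zero}  f g = refl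
sum-tabulate-+ {suc m} f g =
  trans (cong (f Fin.zero + g Fin.zero +_) (sum-tabulate-+ (f ∘ Fin.suc) (g ∘ Fin.suc)))
        (+-interchange (f Fin.zero) (g Fin.zero) _ _)

sum-tabulate-mono : ∀ {m} {f g : Fin m → ℕ} → (∀ i → f i ≤ g i) → sum (tabulate f) ≤ sum (tabulate g)
sum-tabulate-mono {zero}  f≤g = z≤n
sum-tabulate-mono {suc m} f≤g = +-mono-≤ (f≤g Fin.zero) (sum-tabulate-mono (f≤g ∘ Fin.suc))

sum-tabulate-zero : ∀ {m} {f : Fin m → ℕ} → (∀ i → f i ≡ 0) → sum (tabulate f) ≡ 0
sum-tabulate-zero {zero}  f≡0 = refl
sum-tabulate-zero {suc m} f≡0 = cong₂ _+_ (f≡0 Fin.zero) (sum-tabulate-zero (f≡0 ∘ Fin.suc))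

sum-tabulate-δ : ∀ {m} (f : Fin m → ℕ) a → (∀ i → i ≢ a → f i ≡ 0) → sum (tabulate f) ≡ f a
sum-tabulate-δ {suc m} f Fin.zero    f≡0 =
  trans (cong (f Fin.zero +_) (sum-tabulate-zero (λ i → f≡0 (Fin.suc i) λ ())) ) (+-identityʳ _)
sum-tabulate-δ {suc m} f (Fin.suc a) f≡0 =
  cong₂ _+_ (f≡0 Fin.zero λ ()) (sum-tabulate-δ (f ∘ Fin.suc) a (λ i i≢a → f≡0 (Fin.suc i) (i≢a ∘ suc-injective)))

two-elements : ∀ {m} {a b : Fin m} {S : Subset m} → a ≢ b → a ∈ S → b ∈ S → 2 ≤ ∣ S ∣
two-elements {m} {a} {b} {S} a≢b a∈S b∈S = begin
  2                                       ≡⟨ cong₂ _+_ (∣⁅x⁆∣≡1 a) (∣⁅x⁆∣≡1 b) ⟨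
  ∣ ⁅ a ⁆ ∣ + ∣ ⁅ b ⁆ ∣                   ≡⟨ ∣p∪q∣+∣p∩q∣≡∣p∣+∣q∣ ⁅ a ⁆ ⁅ b ⁆ ⟨
  ∣ ⁅ a ⁆ ∪ ⁅ b ⁆ ∣ + ∣ ⁅ a ⁆ ∩ ⁅ b ⁆ ∣ ≡⟨ cong (∣ ⁅ a ⁆ ∪ ⁅ b ⁆ ∣ +_) ∣⁅a⁆∩⁅b⁆∣≡0 ⟩
  ∣ ⁅ a ⁆ ∪ ⁅ b ⁆ ∣ + 0                 ≤⟨ ≤-reflexive (+-identityʳ _) ⟩
  ∣ ⁅ a ⁆ ∪ ⁅ b ⁆ ∣                     ≤⟨ p⊆q⇒∣p∣≤∣q∣ pair⊆S ⟩
  ∣ S ∣                                   ∎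
  where
  open ≤-Reasoning
  ∣⁅a⁆∩⁅b⁆∣≡0 : ∣ ⁅ a ⁆ ∩ ⁅ b ⁆ ∣ ≡ 0
  ∣⁅a⁆∩⁅b⁆∣≡0 = trans (cong ∣_∣ (Empty-unique λ (x , x∈) →
    let x∈a , x∈b = x∈p∩q⁻ ⁅ a ⁆ ⁅ b ⁆ x∈ in a≢b (trans (sym (x∈⁅y⁆⇒x≡y a x∈a)) (x∈⁅y⁆⇒x≡y b x∈b)))) (∣⊥∣≡0 m)
  pair⊆S : ⁅ a ⁆ ∪ ⁅ b ⁆ ⊆ S
  pair⊆S x∈ with x∈p∪q⁻ ⁅ a ⁆ ⁅ b ⁆ x∈
  ... | inj₁ x∈a = subst (_∈ S) (sym (x∈⁅y⁆⇒x≡y a x∈a)) a∈S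
  ... | inj₂ x∈b = subst (_∈ S) (sym (x∈⁅y⁆⇒x≡y b x∈b)) b∈S

elements : ∀ {m} → Subset m → List (Fin m)
elements []           = []
elements (true ∷ᵛ S)  = Fin.zero ∷ map Fin.suc (elements S)
elements (false ∷ᵛ S) = map Fin.suc (elements S)

length-elements : ∀ {m} (S : Subset m) → length (elements S) ≡ ∣ S ∣
length-elements []           = refl
length-elements (true ∷ᵛ S)  = cong suc (trans (length-map Fin.suc (elements S)) (length-elements S))
length-elements (false ∷ᵛ S) = trans (length-map Fin.suc (elements S)) (length-elements S)

∈-elements⁺ : ∀ {m} {S : Subset m} {x} → x ∈ S → x ∈ˡ elements S
∈-elements⁺ {S = true ∷ᵛ S}  hereᵛ       = here refl
∈-elements⁺ {S = true ∷ᵛ S}  (thereᵛ x∈) = there (∈-map⁺ Fin.suc (∈-elements⁺ x∈))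
∈-elements⁺ {S = false ∷ᵛ S} (thereᵛ x∈) = ∈-map⁺ Fin.suc (∈-elements⁺ x∈)

∈-elements⁻ : ∀ {m} (S : Subset m) {x} → x ∈ˡ elements S → x ∈ S
∈-elements⁻ (true ∷ᵛ S) (here refl) = hereᵛ
∈-elements⁻ (true ∷ᵛ S) (there x∈) with ∈-map⁻ Fin.suc x∈
... | _ , y∈ , refl = thereᵛ (∈-elements⁻ S y∈)
∈-elements⁻ (false ∷ᵛ S) x∈ with ∈-map⁻ Fin.suc x∈
... | _ , y∈ , refl = thereᵛ (∈-elements⁻ S y∈)

elements-unique : ∀ {m} (S : Subset m) → Unique (elements S)
elements-unique []           = []
elements-unique (true ∷ᵛ S)  =
  ¬Any⇒All¬ _ (λ zero∈ → case ∈-map⁻ Fin.suc zero∈ of λ ()) ∷ map⁺ suc-injective (elements-unique S)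
elements-unique (false ∷ᵛ S) = map⁺ suc-injective (elements-unique S)

module Walks {n : ℕ} (E : Fin n → Fin n → Bool) where
  open import Data.List.Membership.DecPropositional (_≟_ {n}) using () renaming (_∈?_ to _∈ˡ?_)

  infixr 5 _++ʷ_
  _++ʷ_ : ∀ {u v w i j} → Walk E u v i → Walk E v w j → Walk E u w (i + j)
  stop _   ++ʷ q = q
  step e p ++ʷ q = step e (p ++ʷ q)

  walk? : ∀ k u v → Dec (Walk E u v k)
  walk? zero    u v = map′ (λ { refl → stop u }) (λ { (stop _) → refl }) (u ≟ v)
  walk? (suc k) u v = map′ (λ (w , e , p) → step e p) (λ { (step e p) → _ , e , p })
                           (any? λ w → (E u w ≟ᵇ true) ×-dec walk? k w v)

  infix 4 _⊆ʷ_
  _⊆ʷ_ : ∀ {u v k u′ v′ k′} → Walk E u v k → Walk E u′ v′ k′ → Set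
  q ⊆ʷ p = ∀ {a b} → EdgeIn E q a b → EdgeIn E p a b

  EdgeIn-++⁻ : ∀ {u v w i j a b} (p : Walk E u v i) (q : Walk E v w j) →
               EdgeIn E (p ++ʷ q) a b → EdgeIn E p a b ⊎ EdgeIn E q a b
  EdgeIn-++⁻ (stop _)   q e         = inj₂ e
  EdgeIn-++⁻ (step _ p) q here      = inj₁ here
  EdgeIn-++⁻ (step _ p) q (there e) with EdgeIn-++⁻ p q e
  ... | inj₁ e′ = inj₁ (there e′)
  ... | inj₂ e′ = inj₂ e′

  Uses : ∀ {u v k} → Walk E u v k → Fin n → Fin n → Set
  Uses p a b = EdgeIn E p a b ⊎ EdgeIn E p b a

  Uses-++⁻ : ∀ {u v w i j a b} (p : Walk E u v i) (q : Walk E v w j) →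
             Uses (p ++ʷ q) a b → Uses p a b ⊎ Uses q a b
  Uses-++⁻ p q (inj₁ ab) = Sum.map inj₁ inj₁ (EdgeIn-++⁻ p q ab)
  Uses-++⁻ p q (inj₂ ba) = Sum.map inj₂ inj₂ (EdgeIn-++⁻ p q ba)

  Uses-shared : ∀ {u v k u′ v′ k′ a b} {p : Walk E u v k} {q : Walk E u′ v′ k′} →
                Uses p a b → Uses q a b → SharesEdge E p q
  Uses-shared (inj₁ ab) q-ab = _ , _ , ab , q-ab
  Uses-shared (inj₂ ba) q-ab = _ , _ , ba , Sum.swap q-ab

  EdgeIn⇒E : ∀ {u v k a b} {p : Walk E u v k} → EdgeIn E p a b → E a b ≡ true
  EdgeIn⇒E (here {e = e}) = e
  EdgeIn⇒E (there e)      = EdgeIn⇒E e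

  head∈verts : ∀ {u v k} (p : Walk E u v k) → u ∈ˡ verts E p
  head∈verts (stop _)   = here refl
  head∈verts (step _ _) = here refl

  EdgeIn⇒∈verts : ∀ {u v k a b} {p : Walk E u v k} → EdgeIn E p a b →
                  a ∈ˡ verts E p × b ∈ˡ verts E p
  EdgeIn⇒∈verts {p = step _ p} here = here refl , there (head∈verts p)
  EdgeIn⇒∈verts (there e) with EdgeIn⇒∈verts e
  ... | a∈ , b∈ = there a∈ , there b∈

  Uses⇒∈verts : ∀ {u v k a b} {p : Walk E u v k} → Uses p a b → a ∈ˡ verts E p × b ∈ˡ verts E p
  Uses⇒∈verts (inj₁ ab) = EdgeIn⇒∈verts ab
  Uses⇒∈verts (inj₂ ba) = Product.swap (EdgeIn⇒∈verts ba)

  splitAtVertex : ∀ {u v k x} (p : Walk E u v k) → x ∈ˡ verts E p →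
                  ∃[ i ] ∃[ j ] Walk E u x i × Σ (Walk E x v j) (_⊆ʷ p) × i + j ≡ k
  splitAtVertex (stop u)           (here refl) = 0 , 0 , stop u , (stop u , λ e → e) , refl
  splitAtVertex {k = k} (step e p) (here refl) = 0 , k , stop _ , (step e p , λ e → e) , refl
  splitAtVertex (step e p)         (there x∈) with splitAtVertex p x∈
  ... | i , j , pre , (suf , suf⊆) , i+j≡k =
    suc i , j , step e pre , (suf , λ e′ → there (suf⊆ e′)) , cong suc i+j≡k

  splitAtEdge : ∀ {u v k a b} (p : Walk E u v k) → EdgeIn E p a b →
                ∃[ i ] ∃[ j ] Walk E u a i × Walk E b v j × suc (i + j) ≡ k
  splitAtEdge {k = suc k} (step e p) here = 0 , k , stop _ , p , refl
  splitAtEdge (step e p) (there ab) with splitAtEdge p ab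
  ... | i , j , pre , suf , eq = suc i , j , step e pre , suf , cong suc eq

  record Cut {u v k} (p : Walk E u v k) (i : ℕ) : Set where
    field
      left right : Fin n
      rest       : ℕ
      crossing   : E left right ≡ true
      before     : Walk E u left i
      after      : Walk E right v rest
      length≡    : suc (i + rest) ≡ k

  cutAt : ∀ {u v k} (p : Walk E u v k) i → i < k → Cut p i
  cutAt {k = suc k} (step e p) zero    _         = record
    { crossing = e ; before = stop _ ; after = p ; length≡ = refl }
  cutAt             (step e p) (suc i) i<k       = record
    { crossing = crossing ; before = step e before ; after = after ; length≡ = cong suc length≡ }
    where open Cut (cutAt p i (s≤s⁻¹ i<k))

  record SubPath {u v k} (p : Walk E u v k) : Set where
    field
      len      : ℕ
      path     : Walk E u v len
      unique   : Unique (verts E path)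
      len≤     : len ≤ k
      path⊆    : path ⊆ʷ p

  private
    dropUntil : ∀ {u v k x} (p : Walk E u v k) → x ∈ˡ verts E p → Unique (verts E p) →
                ∃[ j ] Σ (Walk E x v j) λ q → Unique (verts E q) × j ≤ k × q ⊆ʷ p
    dropUntil (stop u)           (here refl) uq = 0 , stop u , uq , ≤-refl , λ e → e
    dropUntil {k = k} (step e p) (here refl) uq = k , step e p , uq , ≤-refl , λ e → e
    dropUntil (step e p)         (there x∈) (_ ∷ uq) with dropUntil p x∈ uq
    ... | j , q , uq′ , j≤k , q⊆ = j , q , uq′ , m≤n⇒m≤1+n j≤k , λ e′ → there (q⊆ e′)

    extend : ∀ {u v w k} (e : E u v ≡ true) {p : Walk E v w k} → SubPath p → SubPath (step e p)
    extend {u} {w = w} e {p} record { len = ℓ ; path = q ; unique = uq ; len≤ = ≤k ; path⊆ = q⊆ }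
      with u ∈ˡ? verts E q
    ... | yes u∈ = shortcut (dropUntil q u∈ uq)
      where
      shortcut : (∃[ j ] Σ (Walk E u w j) λ q′ → Unique (verts E q′) × j ≤ ℓ × q′ ⊆ʷ q) → SubPath (step e p)
      shortcut (_ , q′ , uq′ , ≤k′ , q′⊆) = record
        { path = q′ ; unique = uq′ ; len≤ = m≤n⇒m≤1+n (≤-trans ≤k′ ≤k) ; path⊆ = λ e′ → there (q⊆ (q′⊆ e′)) }
    ... | no u∉ = record
      { path = step e q ; unique = ¬Any⇒All¬ (verts E q) u∉ ∷ uq ; len≤ = s≤s ≤k
      ; path⊆ = λ { here → here ; (there e′) → there (q⊆ e′) } }

  toPath : ∀ {u v k} (p : Walk E u v k) → SubPath p
  toPath (stop u)   = record { path = stop u ; unique = [] ∷ [] ; len≤ = ≤-refl ; path⊆ = λ e → e }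
  toPath (step e p) = extend e (toPath p)

module SymmetricWalks {n : ℕ} (E : Fin n → Fin n → Bool) (E-sym : ∀ u v → E u v ≡ E v u) where
  open Walks E

  E-flip : ∀ {u v} → E u v ≡ true → E v u ≡ true
  E-flip {u} {v} e = trans (E-sym v u) e

  reverse : ∀ {u v k} → Walk E u v k → Walk E v u k
  reverse (stop u) = stop u
  reverse (step {k = k} e p) = subst (Walk E _ _) (+-comm k 1) (reverse p ++ʷ step (E-flip e) (stop _))

  EdgeIn-reverse : ∀ {u v k a b} (p : Walk E u v k) → EdgeIn E (reverse p) a b → EdgeIn E p b a
  EdgeIn-reverse (step {k = k} e p) ba
    with EdgeIn-++⁻ (reverse p) (step (E-flip e) (stop _)) (unsubst (+-comm k 1) ba)
    where
    unsubst : ∀ {u v i j a b} {q : Walk E u v i} (eq : i ≡ j) →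
              EdgeIn E (subst (Walk E u v) eq q) a b → EdgeIn E q a b
    unsubst refl e = e
  ... | inj₁ ba′ = there (EdgeIn-reverse p ba′)
  ... | inj₂ here = here

  Uses⇒E : ∀ {u v k a b} {p : Walk E u v k} → Uses p a b → E a b ≡ true
  Uses⇒E (inj₁ ab) = EdgeIn⇒E ab
  Uses⇒E (inj₂ ba) = E-flip (EdgeIn⇒E ba)

  Uses-reverse : ∀ {u v k a b} (p : Walk E u v k) → Uses (reverse p) a b → Uses p a b
  Uses-reverse p = Sum.swap ∘ Sum.map (EdgeIn-reverse p) (EdgeIn-reverse p)

module RetypeWalks {n : ℕ} {E F : Fin n → Fin n → Bool} where
  open Walks E using (EdgeIn⇒E)

  EdgesIn : ∀ {u v k} → Walk E u v k → Set
  EdgesIn p = ∀ {a b} → EdgeIn E p a b → F a b ≡ true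

  retype : ∀ {u v k} (p : Walk E u v k) → EdgesIn p → Walk F u v k
  retype (stop u)   h = stop u
  retype (step e p) h = step (h here) (retype p (λ ab → h (there ab)))

  verts-retype : ∀ {u v k} (p : Walk E u v k) (h : EdgesIn p) → verts F (retype p h) ≡ verts E p
  verts-retype (stop u)       h = refl
  verts-retype (step {u} e p) h = cong (u ∷_) (verts-retype p _)

  EdgeIn-retype⁻ : ∀ {u v k a b} (p : Walk E u v k) (h : EdgesIn p) → EdgeIn F (retype p h) a b → EdgeIn E p a b
  EdgeIn-retype⁻ (step e p) h here       = here
  EdgeIn-retype⁻ (step e p) h (there ab) = there (EdgeIn-retype⁻ p _ ab)

  Uses-retype⁻ : ∀ {u v k a b} (p : Walk E u v k) (h : EdgesIn p) →
                 Walks.Uses F (retype p h) a b → Walks.Uses E p a b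
  Uses-retype⁻ p h = Sum.map (EdgeIn-retype⁻ p h) (EdgeIn-retype⁻ p h)

  mapWalk : (∀ {a b} → E a b ≡ true → F a b ≡ true) → ∀ {u v k} → Walk E u v k → Walk F u v k
  mapWalk E⊆F p = retype p (λ ab → E⊆F (EdgeIn⇒E ab))

module EdgeRelations {n : ℕ} where

  BoolRel : Set
  BoolRel = Fin n → Fin n → Bool

  infixr 6 _∪ᵉ_
  infixr 7 _∩ᵉ_
  _∪ᵉ_ _∩ᵉ_ : BoolRel → BoolRel → BoolRel
  (E ∪ᵉ F) u v = E u v ∨ F u v
  (E ∩ᵉ F) u v = E u v ∧ F u v

  _⊆ᵉ_ : BoolRel → BoolRel → Set
  E ⊆ᵉ F = ∀ u v → E u v ≡ true → F u v ≡ true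

  Disjointᵉ : BoolRel → BoolRel → Set
  Disjointᵉ E F = ∀ u v → E u v ≡ true → F u v ≡ true → ⊥

  edge : Fin n → Fin n → BoolRel
  edge a b u v = (does (a ≟ u) ∧ does (b ≟ v)) ∨ (does (a ≟ v) ∧ does (b ≟ u))

  edge⁻ : ∀ {a b u v} → edge a b u v ≡ true → (a ≡ u × b ≡ v) ⊎ (a ≡ v × b ≡ u)
  edge⁻ h with ∨-true⁻ h
  ... | inj₁ h′ = inj₁ (from-does (_ ≟ _) (proj₁ (∧-true⁻ h′)) , from-does (_ ≟ _) (proj₂ (∧-true⁻ h′)))
  ... | inj₂ h′ = inj₂ (from-does (_ ≟ _) (proj₁ (∧-true⁻ h′)) , from-does (_ ≟ _) (proj₂ (∧-true⁻ h′)))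

  edge-here : ∀ a b → edge a b a b ≡ true
  edge-here a b = ∨-trueˡ (∧-true⁺ (dec-true (a ≟ a) refl) (dec-true (b ≟ b) refl))

  edge-sym : ∀ a b u v → edge a b u v ≡ edge a b v u
  edge-sym a b u v = ∨-comm (does (a ≟ u) ∧ does (b ≟ v)) _

  edge-comm : ∀ a b u v → edge a b u v ≡ edge b a u v
  edge-comm a b u v =
    trans (∨-comm (does (a ≟ u) ∧ does (b ≟ v)) _) (cong₂ _∨_ (∧-comm (does (a ≟ v)) _) (∧-comm (does (a ≟ u)) _))

  row : BoolRel → Fin n → Subset n
  row E u = tabulate (λ v → E u v ∧ (toℕ u <ᵇ toℕ v))

  edgeCount-cong : ∀ {E F : BoolRel} → (∀ u v → E u v ≡ F u v) → edgeCount E ≡ edgeCount F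
  edgeCount-cong E≡F = cong sum (tabulate-cong λ u → cong ∣_∣ (tabulate-cong λ v → cong (_∧ _) (E≡F u v)))

  edgeCount-mono : ∀ {E F : BoolRel} → E ⊆ᵉ F → edgeCount E ≤ edgeCount F
  edgeCount-mono {E} {F} E⊆F = sum-tabulate-mono λ u → p⊆q⇒∣p∣≤∣q∣ λ {v} v∈ →
    let Euv , u<v = ∧-true⁻ (∈-tabulate⁻ {f = λ v → E u v ∧ _} v∈)
    in ∈-tabulate⁺ {f = λ v → F u v ∧ _} (∧-true⁺ (E⊆F u v Euv) u<v)

  edgeCount-empty : ∀ {E : BoolRel} → (∀ u v → E u v ≢ true) → edgeCount E ≡ 0
  edgeCount-empty {E} E≢true =
    sum-tabulate-zero λ u → ∣tabulate∣-empty {f = λ v → E u v ∧ _} λ v → E≢true u v ∘ proj₁ ∘ ∧-true⁻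

  edgeCount-∪∩ : ∀ (E F : BoolRel) → edgeCount (E ∪ᵉ F) + edgeCount (E ∩ᵉ F) ≡ edgeCount E + edgeCount F
  edgeCount-∪∩ E F = begin
    edgeCount (E ∪ᵉ F) + edgeCount (E ∩ᵉ F)                  ≡⟨ sum-tabulate-+ (∣_∣ ∘ row (E ∪ᵉ F)) (∣_∣ ∘ row (E ∩ᵉ F)) ⟨
    sum (tabulate λ u → ∣ row (E ∪ᵉ F) u ∣ + ∣ row (E ∩ᵉ F) u ∣) ≡⟨ cong sum (tabulate-cong rowwise) ⟩
    sum (tabulate λ u → ∣ row E u ∣ + ∣ row F u ∣)              ≡⟨ sum-tabulate-+ (∣_∣ ∘ row E) (∣_∣ ∘ row F) ⟩
    edgeCount E + edgeCount F                                ∎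
    where
    open ≡-Reasoning
    rowwise : ∀ u → ∣ row (E ∪ᵉ F) u ∣ + ∣ row (E ∩ᵉ F) u ∣ ≡ ∣ row E u ∣ + ∣ row F u ∣
    rowwise u = begin
      ∣ row (E ∪ᵉ F) u ∣ + ∣ row (E ∩ᵉ F) u ∣
        ≡⟨ cong₂ (λ p q → ∣ p ∣ + ∣ q ∣)
                 (trans (tabulate-cong λ v → ∧-distribʳ-∨ _ (E u v) (F u v)) (tabulate-zipWith _∨_ _ _))
                 (trans (tabulate-cong λ v → ∧-distribʳ-∧ _ (E u v) (F u v)) (tabulate-zipWith _∧_ _ _)) ⟩
      ∣ row E u ∪ row F u ∣ + ∣ row E u ∩ row F u ∣
        ≡⟨ ∣p∪q∣+∣p∩q∣≡∣p∣+∣q∣ (row E u) (row F u) ⟩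
      ∣ row E u ∣ + ∣ row F u ∣ ∎

  edgeCount-∪ : ∀ (E F : BoolRel) → edgeCount (E ∪ᵉ F) ≤ edgeCount E + edgeCount F
  edgeCount-∪ E F = ≤-trans (m≤m+n _ _) (≤-reflexive (edgeCount-∪∩ E F))

  edgeCount-∪-disjoint : ∀ {E F : BoolRel} → Disjointᵉ E F → edgeCount (E ∪ᵉ F) ≡ edgeCount E + edgeCount F
  edgeCount-∪-disjoint {E} {F} E#F = begin
    edgeCount (E ∪ᵉ F)                            ≡⟨ +-identityʳ _ ⟨
    edgeCount (E ∪ᵉ F) + 0                        ≡⟨ cong (edgeCount (E ∪ᵉ F) +_) (edgeCount-empty {E ∩ᵉ F} λ u v EF →
                                                       let Euv , Fuv = ∧-true⁻ EF in E#F u v Euv Fuv) ⟨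
    edgeCount (E ∪ᵉ F) + edgeCount (E ∩ᵉ F)       ≡⟨ edgeCount-∪∩ E F ⟩
    edgeCount E + edgeCount F                     ∎
    where open ≡-Reasoning

  ⋃ᵉ : ∀ {I : Set} → List I → (I → BoolRel) → BoolRel
  ⋃ᵉ []      f u v = false
  ⋃ᵉ (s ∷ L) f u v = (f s ∪ᵉ ⋃ᵉ L f) u v

  ⋃ᵉ⁻ : ∀ {I : Set} (L : List I) {f u v} → ⋃ᵉ L f u v ≡ true → ∃[ s ] s ∈ˡ L × f s u v ≡ true
  ⋃ᵉ⁻ (s ∷ L) {f} {u} {v} h with ∨-true⁻ {f s u v} h
  ... | inj₁ fs = s , here refl , fs
  ... | inj₂ h′ with ⋃ᵉ⁻ L h′
  ...   | t , t∈ , ft = t , there t∈ , ft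

  ⋃ᵉ⁺ : ∀ {I : Set} {L : List I} {f s u v} → s ∈ˡ L → f s u v ≡ true → ⋃ᵉ L f u v ≡ true
  ⋃ᵉ⁺ (here refl)           fs = ∨-trueˡ fs
  ⋃ᵉ⁺ {L = t ∷ _} {f} {u = u} {v} (there s∈) fs = ∨-trueʳ {f t u v} (⋃ᵉ⁺ s∈ fs)

  ⋃ᵉ-sym : ∀ {I : Set} (L : List I) {f} → (∀ s u v → f s u v ≡ f s v u) → ∀ u v → ⋃ᵉ L f u v ≡ ⋃ᵉ L f v u
  ⋃ᵉ-sym []      f-sym u v = refl
  ⋃ᵉ-sym (s ∷ L) f-sym u v = cong₂ _∨_ (f-sym s u v) (⋃ᵉ-sym L f-sym u v)

  edgeCount-⋃ᵉ≤ : ∀ {I : Set} (L : List I) {f c} → (∀ s → edgeCount (f s) ≤ c) →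
                  edgeCount (⋃ᵉ L f) ≤ length L * c
  edgeCount-⋃ᵉ≤ []      f≤c = ≤-reflexive (edgeCount-empty λ _ _ ())
  edgeCount-⋃ᵉ≤ (s ∷ L) {f} f≤c =
    ≤-trans (edgeCount-∪ (f s) (⋃ᵉ L f)) (+-mono-≤ (f≤c s) (edgeCount-⋃ᵉ≤ L f≤c))

  edgeCount-⋃ᵉ : ∀ {I : Set} (L : List I) {f c} → Unique L → (∀ {s} → s ∈ˡ L → edgeCount (f s) ≡ c) →
                 (∀ {s t} → s ∈ˡ L → t ∈ˡ L → s ≢ t → Disjointᵉ (f s) (f t)) →
                 edgeCount (⋃ᵉ L f) ≡ length L * c
  edgeCount-⋃ᵉ []      _          _   _        = edgeCount-empty λ _ _ ()
  edgeCount-⋃ᵉ (s ∷ L) {f} (s∉L ∷ uL) f≡c disjoint =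
    trans (edgeCount-∪-disjoint {f s} {⋃ᵉ L f} disjoint-rest)
          (cong₂ _+_ (f≡c (here refl)) (edgeCount-⋃ᵉ L uL (f≡c ∘ there) λ s∈ t∈ → disjoint (there s∈) (there t∈)))
    where
    disjoint-rest : Disjointᵉ (f s) (⋃ᵉ L f)
    disjoint-rest u v fs rest with ⋃ᵉ⁻ L rest
    ... | t , t∈ , ft = disjoint (here refl) (there t∈) (All.lookup s∉L t∈) u v fs ft

  private
    edgeCount-edge< : ∀ {a b} → toℕ a < toℕ b → edgeCount (edge a b) ≡ 1
    edgeCount-edge< {a} {b} a<b = begin
      edgeCount (edge a b)       ≡⟨ sum-tabulate-δ (λ u → ∣ row (edge a b) u ∣) a
                                      (λ u u≢a → ∣tabulate∣-empty {f = λ v → edge a b u v ∧ _} λ v → u≢a ∘ from-a) ⟩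
      ∣ row (edge a b) a ∣       ≡⟨ cong ∣_∣ (⊆-antisym row⊆⁅b⁆ ⁅b⁆⊆row) ⟩
      ∣ ⁅ b ⁆ ∣                  ≡⟨ ∣⁅x⁆∣≡1 b ⟩
      1                          ∎
      where
      open ≡-Reasoning
      increasing : ∀ {u v} → (edge a b u v ∧ (toℕ u <ᵇ toℕ v)) ≡ true → u ≡ a × v ≡ b
      increasing {u} {v} h with ∧-true⁻ {edge a b u v} h
      ... | ab , u<v with edge⁻ {a} {b} {u} {v} ab
      ...   | inj₁ (refl , refl) = refl , refl
      ...   | inj₂ (refl , refl) = ⊥-elim (<-asym a<b (<ᵇ⇒< _ _ (Equivalence.from T-≡ u<v)))
      from-a : ∀ {u v} → (edge a b u v ∧ (toℕ u <ᵇ toℕ v)) ≡ true → u ≡ a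
      from-a = proj₁ ∘ increasing
      row⊆⁅b⁆ : row (edge a b) a ⊆ ⁅ b ⁆
      row⊆⁅b⁆ {v} v∈ =
        subst (_∈ ⁅ b ⁆) (sym (proj₂ (increasing (∈-tabulate⁻ {f = λ v → edge a b a v ∧ _} v∈)))) (x∈⁅x⁆ b)
      ⁅b⁆⊆row : ⁅ b ⁆ ⊆ row (edge a b) a
      ⁅b⁆⊆row {v} v∈ with x∈⁅y⁆⇒x≡y b v∈
      ... | refl = ∈-tabulate⁺ {f = λ v → edge a b a v ∧ _} (∧-true⁺ (edge-here a b) (Equivalence.to T-≡ (<⇒<ᵇ a<b)))

  edgeCount-edge : ∀ {a b} → a ≢ b → edgeCount (edge a b) ≡ 1
  edgeCount-edge {a} {b} a≢b with <-cmp (toℕ a) (toℕ b)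
  ... | tri< a<b _ _ = edgeCount-edge< a<b
  ... | tri≈ _ a≡b _ = ⊥-elim (a≢b (toℕ-injective a≡b))
  ... | tri> _ _ b<a = trans (edgeCount-cong {edge a b} {edge b a} (edge-comm a b)) (edgeCount-edge< b<a)

module GraphWalks {n : ℕ} (G : Graph n) where
  open Graph G
  open EdgeRelations {n}
  open Walks adj public
  open SymmetricWalks adj adj-sym public

  adj⇒≢ : ∀ {a b} → adj a b ≡ true → a ≢ b
  adj⇒≢ {a} ab refl with trans (sym ab) (adj-irrefl a)
  ... | ()

  edgesOf : ∀ {u v k} → Walk adj u v k → BoolRel
  edgesOf (stop _)           _ _ = false
  edgesOf (step {u} {v} _ p) a b = (edge u v ∪ᵉ edgesOf p) a b

  edgesOf-sym : ∀ {u v k} (p : Walk adj u v k) a b → edgesOf p a b ≡ edgesOf p b a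
  edgesOf-sym (stop _)           a b = refl
  edgesOf-sym (step {u} {v} e p) a b = cong₂ _∨_ (edge-sym u v a b) (edgesOf-sym p a b)

  edgesOf⁻ : ∀ {u v k a b} (p : Walk adj u v k) → edgesOf p a b ≡ true → Uses p a b
  edgesOf⁻ {a = a} {b} (step {u} {v} e p) h with ∨-true⁻ {edge u v a b} h
  ... | inj₂ h′ = Sum.map there there (edgesOf⁻ p h′)
  ... | inj₁ h′ with edge⁻ {u} {v} {a} {b} h′
  ...   | inj₁ (refl , refl) = inj₁ here
  ...   | inj₂ (refl , refl) = inj₂ here

  edgesOf⁺ : ∀ {u v k a b} (p : Walk adj u v k) → Uses p a b → edgesOf p a b ≡ true
  edgesOf⁺ p (inj₁ ab) = EdgeIn⇒edgesOf p ab
    where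
    EdgeIn⇒edgesOf : ∀ {u v k a b} (p : Walk adj u v k) → EdgeIn adj p a b → edgesOf p a b ≡ true
    EdgeIn⇒edgesOf (step {u} {v} e p) here       = ∨-trueˡ (edge-here u v)
    EdgeIn⇒edgesOf (step {u} {v} e p) (there ab) = ∨-trueʳ {edge u v _ _} (EdgeIn⇒edgesOf p ab)
  edgesOf⁺ {a = a} {b} p (inj₂ ba) = trans (edgesOf-sym p a b) (edgesOf⁺ p (inj₁ ba))

  edgesOf⇒adj : ∀ {u v k} (p : Walk adj u v k) → edgesOf p ⊆ᵉ adj
  edgesOf⇒adj p a b = Uses⇒E ∘ edgesOf⁻ p

  edgesOf⇒∈verts : ∀ {u v k a b} (p : Walk adj u v k) → edgesOf p a b ≡ true →
                   a ∈ˡ verts adj p × b ∈ˡ verts adj p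
  edgesOf⇒∈verts p = Uses⇒∈verts ∘ edgesOf⁻ p

  edgeCount-edgesOf≤ : ∀ {u v k} (p : Walk adj u v k) → edgeCount (edgesOf p) ≤ k
  edgeCount-edgesOf≤ (stop _)           = ≤-reflexive (edgeCount-empty λ _ _ ())
  edgeCount-edgesOf≤ (step {u} {v} e p) = begin
    edgeCount (edge u v ∪ᵉ edgesOf p)           ≤⟨ edgeCount-∪ (edge u v) (edgesOf p) ⟩
    edgeCount (edge u v) + edgeCount (edgesOf p) ≡⟨ cong (_+ _) (edgeCount-edge (adj⇒≢ e)) ⟩
    suc (edgeCount (edgesOf p))                 ≤⟨ s≤s (edgeCount-edgesOf≤ p) ⟩
    suc _                                       ∎
    where open ≤-Reasoning

  edgeCount-edgesOf-path : ∀ {u v k} (p : Walk adj u v k) → Unique (verts adj p) → edgeCount (edgesOf p) ≡ k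
  edgeCount-edgesOf-path (stop _)           _          = edgeCount-empty λ _ _ ()
  edgeCount-edgesOf-path (step {u} {v} e p) (u∉p ∷ up) = begin
    edgeCount (edge u v ∪ᵉ edgesOf p)            ≡⟨ edgeCount-∪-disjoint {edge u v} {edgesOf p} disjoint ⟩
    edgeCount (edge u v) + edgeCount (edgesOf p)
      ≡⟨ cong₂ _+_ (edgeCount-edge (adj⇒≢ e)) (edgeCount-edgesOf-path p up) ⟩
    suc _                                        ∎
    where
    open ≡-Reasoning
    disjoint : Disjointᵉ (edge u v) (edgesOf p)
    disjoint a b uv ab with edge⁻ {u} {v} {a} {b} uv | edgesOf⇒∈verts p ab
    ... | inj₁ (refl , _) | a∈p , _ = All.lookup u∉p a∈p refl
    ... | inj₂ (refl , _) | _ , b∈p = All.lookup u∉p b∈p refl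

module TreeWalks {n : ℕ} (T : Tree n) where
  open Tree T
  open EdgeRelations {n}
  open GraphWalks graph public

  returnWalk-uses-edge : ∀ {a b k} → adj a b ≡ true → (q : Walk adj b a k) → Uses q a b
  returnWalk-uses-edge {a} {b} ab q with toPath q
  ... | record { path = stop _ }                         = ⊥-elim (adj⇒≢ ab refl)
  ... | record { path = step _ (stop _) ; path⊆ = q′⊆q } = inj₂ (q′⊆q here)
  ... | record { path = step e (step e′ r) ; unique = uq } =
    ⊥-elim (acyclic (a , b , _ , ab , step e (step e′ r) , uq))

  dist-exists : ∀ u v → ∃[ k ] Dist T u v k
  dist-exists u v = least (λ k → walk? k u v) (proj₂ (connected u v ∈⊤ ∈⊤))

  geodesic-split : ∀ {u v a i j d} → Dist T u v d → Walk adj u a i → Walk adj a v j → i + j ≡ d →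
                   (∀ {m} → Walk adj a u m → i ≤ m) × (∀ {m} → Walk adj a v m → j ≤ m)
  geodesic-split {i = i} {j} (_ , shortest) pre suf i+j≡d =
    (λ {m} q → +-cancelʳ-≤ j i m (≤-trans (≤-reflexive i+j≡d) (shortest _ (reverse q ++ʷ suf)))) ,
    (λ {m} q → +-cancelˡ-≤ i j m (≤-trans (≤-reflexive i+j≡d) (shortest _ (pre ++ʷ q))))

  module _ (F : BoolRel) (F-sym : ∀ u v → F u v ≡ F v u) (F⊆adj : F ⊆ᵉ adj) (root : Fin n)
           (reach : ∀ u v → F u v ≡ true → ∃[ k ] Walk F u root k) where
    open RetypeWalks {n} {F} {adj}
    open Walks F using () renaming (_++ʷ_ to _++ᶠ_)
    open SymmetricWalks F F-sym using () renaming (reverse to reverseᶠ)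

    support : Subset n
    support = tabulate λ v → does (v ≟ root) ∨ does (any? λ u → F v u ≟ᵇ true)

    reach⇒∈support : ∀ {v k} → Walk F v root k → v ∈ support
    reach⇒∈support (stop _) = ∈-tabulate⁺ (∨-trueˡ (dec-true (root ≟ root) refl))
    reach⇒∈support {v} (step e _) =
      ∈-tabulate⁺ (∨-trueʳ {does (v ≟ root)} (dec-true (any? λ u → F v u ≟ᵇ true) (_ , e)))

    private
      ∈support⇒reach : ∀ {v} → v ∈ support → ∃[ k ] Walk F v root k
      ∈support⇒reach {v} v∈ with ∨-true⁻ {does (v ≟ root)} (∈-tabulate⁻ v∈)
      ... | inj₁ v≡root with from-does (v ≟ root) v≡root
      ...   | refl = 0 , stop root
      ∈support⇒reach {v} v∈ | inj₂ has-edge =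
        let u , e = from-does (any? λ u → F v u ≟ᵇ true) has-edge in reach v u e

    subtreeOf : Subtree T
    subtreeOf = record
      { W      = support
      ; F      = F
      ; F-sym  = F-sym
      ; F-adj  = F⊆adj
      ; F-in   = λ u v e → reach⇒∈support (proj₂ (reach u v e))
                         , reach⇒∈support (proj₂ (reach v u (trans (F-sym v u) e)))
      ; W-ne   = root , reach⇒∈support (stop root)
      ; F-conn = λ u v u∈ v∈ → let i , p = ∈support⇒reach u∈ ; j , q = ∈support⇒reach v∈
                               in i + j , p ++ᶠ reverseᶠ q
      ; F-acyc = λ (a , b , k , ab , cyc , uq) →
          acyclic (a , b , k , F⊆adj a b ab , mapWalk (F⊆adj _ _) cyc ,
                   subst Unique (sym (verts-retype cyc _)) uq)
      }

module Diametral {n : ℕ} (T : Tree n) {d u₀ u_d} (P : Walk (Tree.adj T) u₀ u_d d)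
                 (diameter : IsDiameter T d) (P-geodesic : Dist T u₀ u_d d) (1≤d : 1 ≤ d) where
  open Tree T
  open TreeWalks T
  open EdgeRelations {n}

  -- R = ⌈d/2⌉ turns out to be the radius of T.
  r ε R : ℕ
  r = d / 2
  ε = d % 2
  R = r + ε

  ε≤1 : ε ≤ 1
  ε≤1 = s≤s⁻¹ (m%n<n d 2)

  ε≡0⊎ε≡1 : ε ≡ 0 ⊎ ε ≡ 1
  ε≡0⊎ε≡1 with ε | ε≤1
  ... | zero  | _       = inj₁ refl
  ... | suc _ | s≤s z≤n = inj₂ refl

  d≡r+R : d ≡ r + R
  d≡r+R = trans (m≡m%n+[m/n]*n d 2) (solve 2 (λ r ε → ε :+ r :* con 2 := r :+ (r :+ ε)) refl r ε)
    where open +-*-Solver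

  r≤R : r ≤ R
  r≤R = m≤m+n r ε

  R≤1+r : R ≤ suc r
  R≤1+r = ≤-trans (+-monoʳ-≤ r ε≤1) (≤-reflexive (+-comm r 1))

  r<d : r < d
  r<d = subst (r <_) (sym d≡r+R) (m<m+R r (subst (1 ≤_) d≡r+R 1≤d) r≤R)
    where
    m<m+R : ∀ m → 1 ≤ m + R → m ≤ R → m < m + R
    m<m+R zero    1≤R _   = 1≤R
    m<m+R (suc m) _   m≤R = m<m+n (suc m) (≤-trans (s≤s z≤n) m≤R)

  -- Opaque: letting the type checker unfold these definitions makes checking intractable.
  opaque
    middle : Cut P r
    middle = cutAt P r r<d

  open Cut middle renaming (left to x; right to y; crossing to xy)

  yx : adj y x ≡ true
  yx = E-flip xy

  1+rest≡R : suc rest ≡ R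
  1+rest≡R = +-cancelˡ-≡ r _ _ (trans (+-suc r rest) (trans length≡ d≡r+R))

  x-geodesic : (∀ {m} → Walk adj x u₀ m → r ≤ m) × (∀ {m} → Walk adj x u_d m → suc rest ≤ m)
  x-geodesic = geodesic-split P-geodesic before (step xy after) (trans (+-suc r rest) length≡)

  y-geodesic : (∀ {m} → Walk adj y u₀ m → r + 1 ≤ m) × (∀ {m} → Walk adj y u_d m → rest ≤ m)
  y-geodesic = geodesic-split P-geodesic (before ++ʷ step xy (stop y)) after
                              (trans (+-assoc r 1 rest) (trans (+-suc r rest) length≡))

  x→u₀ : ∀ {m} → Walk adj x u₀ m → r ≤ m
  x→u₀ = proj₁ x-geodesic

  x→u_d : ∀ {m} → Walk adj x u_d m → R ≤ m
  x→u_d {m} q = subst (_≤ m) 1+rest≡R (proj₂ x-geodesic q)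

  y→u₀ : ∀ {m} → Walk adj y u₀ m → suc r ≤ m
  y→u₀ {m} q = subst (_≤ m) (+-comm r 1) (proj₁ y-geodesic q)

  y→u_d : ∀ {m} → Walk adj y u_d m → rest ≤ m
  y→u_d = proj₂ y-geodesic

  x∉after : x ∈ˡ verts adj after → ⊥
  x∉after x∈ with splitAtVertex after x∈
  ... | i , j , _ , (x→ , _) , i+j≡rest =
    <-irrefl refl (subst (_≤ rest) (sym 1+rest≡R) (≤-trans (x→u_d x→) (subst (j ≤_) i+j≡rest (m≤n+m j i))))

  y∉before : y ∈ˡ verts adj before → ⊥
  y∉before y∈ with splitAtVertex before y∈
  ... | i , j , →y , _ , i+j≡r =
    <-irrefl refl (≤-trans (y→u₀ (reverse →y)) (subst (i ≤_) i+j≡r (m≤m+n i j)))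

  crossing : ∀ {k} (W : Walk adj u₀ u_d k) → Uses W x y
  crossing W with Uses-++⁻ after _ (returnWalk-uses-edge xy (after ++ʷ reverse W ++ʷ before))
  ... | inj₁ in-after = ⊥-elim (x∉after (proj₁ (Uses⇒∈verts in-after)))
  ... | inj₂ elsewhere with Uses-++⁻ (reverse W) before elsewhere
  ...   | inj₁ in-W      = Uses-reverse W in-W
  ...   | inj₂ in-before = ⊥-elim (y∉before (proj₂ (Uses⇒∈verts in-before)))

  Hub : Fin n → Set
  Hub c = c ≡ x ⊎ (ε ≡ 1 × c ≡ y)

  record HubPath (s : Fin n) : Set where
    field
      hub    : Fin n
      isHub  : Hub hub
      len    : ℕ
      len≤r  : len ≤ r
      path   : Walk adj s hub len
      unique : Unique (verts adj path)

  hubPathVia : ∀ {s c ℓ} → Hub c → Walk adj s c ℓ → ℓ ≤ r → HubPath s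
  hubPathVia c-hub w ℓ≤r = record
    { isHub = c-hub ; len≤r = ≤-trans len≤ ℓ≤r ; path = path ; unique = unique }
    where open SubPath (toPath w)

  open HubPath

  private
    viaX : ∀ {s i} → Walk adj s x i → i ≤ r → HubPath s
    viaX = hubPathVia (inj₁ refl)

    viaY : ∀ {s i} → Walk adj s y i → suc i ≤ R → HubPath s
    viaY {i = i} w 1+i≤R with ε≡0⊎ε≡1
    ... | inj₁ ε≡0 = viaX (w ++ʷ step yx (stop x))
                          (subst₂ _≤_ (+-comm 1 i) (trans (cong (r +_) ε≡0) (+-identityʳ r)) 1+i≤R)
    ... | inj₂ ε≡1 = hubPathVia (inj₂ (ε≡1 , refl)) w
                                (s≤s⁻¹ (subst (suc i ≤_) (trans (cong (r +_) ε≡1) (+-comm r 1)) 1+i≤R))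

    shorten : ∀ {i m g k} → suc (i + m) ≡ k → k ≤ d → g ≤ m → suc (i + g) ≤ d
    shorten {i} 1+i+m≡k k≤d g≤m = ≤-trans (s≤s (+-monoʳ-≤ i g≤m)) (subst (_≤ d) (sym 1+i+m≡k) k≤d)

    ≤diameter : ∀ {s t k} → Dist T s t k → k ≤ d
    ≤diameter = proj₂ diameter _ _ _

    d≤R+r : d ≤ R + r
    d≤R+r = ≤-reflexive (trans d≡r+R (+-comm r R))

    d≤r+1+r : d ≤ r + suc r
    d≤r+1+r = ≤-trans (≤-reflexive d≡r+R) (+-monoʳ-≤ r R≤1+r)

  -- The geodesics from s to u₀ and to u_d join into a u₀–u_d walk, so one of them uses xy. Its part
  -- beyond xy is no shorter than the matching end of P, which leaves at most r for the part before.
  opaque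
    hubPath : ∀ s → HubPath s
    hubPath s with dist-exists s u₀ | dist-exists s u_d
    ... | k₀ , dist₀@(w₀ , _) | k_d , dist_d@(w_d , _)
      with Uses-++⁻ (reverse w₀) w_d (crossing (reverse w₀ ++ʷ w_d))
    ... | inj₁ in-w₀ with Uses-reverse w₀ in-w₀
    ...   | inj₁ x-first with splitAtEdge w₀ x-first
    ...     | i , m , s→x , y→ , eq =
      viaX s→x (<⇒≤ (+-cancelʳ-≤ (suc r) (suc i) r
        (≤-trans (shorten eq (≤diameter dist₀) (y→u₀ y→)) d≤r+1+r)))
    hubPath s | k₀ , dist₀@(w₀ , _) | _ | inj₁ _ | inj₂ y-first with splitAtEdge w₀ y-first
    ...     | i , m , s→y , x→ , eq =
      viaY s→y (+-cancelʳ-≤ r (suc i) R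
        (≤-trans (shorten eq (≤diameter dist₀) (x→u₀ x→)) d≤R+r))
    hubPath s | _ | k_d , dist_d@(w_d , _) | inj₂ (inj₁ x-first) with splitAtEdge w_d x-first
    ...     | i , m , s→x , y→ , eq =
      viaX s→x (+-cancelʳ-≤ rest i r (s≤s⁻¹
        (≤-trans (shorten eq (≤diameter dist_d) (y→u_d y→)) (≤-reflexive (sym length≡)))))
    hubPath s | _ | k_d , dist_d@(w_d , _) | inj₂ (inj₂ y-first) with splitAtEdge w_d y-first
    ...     | i , m , s→y , x→ , eq =
      viaY s→y (≤-trans (+-cancelʳ-≤ R (suc i) r
        (≤-trans (shorten eq (≤diameter dist_d) (x→u_d x→)) (≤-reflexive d≡r+R))) r≤R)

  hubLink : ∀ {c c′} → Hub c → Hub c′ →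
            ∃[ k ] k ≤ ε × Σ (Walk adj c c′ k) λ l → ∀ {a b} → Uses l a b → Hub a
  hubLink (inj₁ refl)       (inj₁ refl)       = 0 , z≤n , stop x , λ { (inj₁ ()) ; (inj₂ ()) }
  hubLink (inj₁ refl)       (inj₂ (ε≡1 , refl)) =
    1 , ≤-reflexive (sym ε≡1) , step xy (stop y) , λ { (inj₁ here) → inj₁ refl ; (inj₂ here) → inj₂ (ε≡1 , refl) }
  hubLink (inj₂ (ε≡1 , refl)) (inj₁ refl)       =
    1 , ≤-reflexive (sym ε≡1) , step yx (stop x) , λ { (inj₁ here) → inj₂ (ε≡1 , refl) ; (inj₂ here) → inj₁ refl }
  hubLink (inj₂ (_ , refl)) (inj₂ (_ , refl)) = 0 , z≤n , stop y , λ { (inj₁ ()) ; (inj₂ ()) }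

  hub-covers : ∀ {c} → Hub c → ∀ s → ∃[ k ] k ≤ R × Walk adj c s k
  hub-covers c-hub s =
    let k , k≤ε , link , _ = hubLink c-hub (isHub (hubPath s))
    in k + len (hubPath s) , ≤-trans (+-mono-≤ k≤ε (len≤r (hubPath s))) (≤-reflexive (+-comm ε r)) ,
       link ++ʷ reverse (path (hubPath s))

  radius≤ecc : ∀ {w e} → Ecc T w e → R ≤ e
  radius≤ecc {w} {e} (within , _) with within u₀ | within u_d
  ... | k₀ , (w₀ , _) , k₀≤e | k_d , (w_d , _) , k_d≤e = ≮⇒≥ λ e<R →
    ≤⇒≯ d≤e+e (subst (_ <_) (sym d≡r+R) (+-mono-≤-< (s≤s⁻¹ (≤-trans e<R R≤1+r)) e<R))
    where
    d≤e+e : d ≤ e + e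
    d≤e+e = ≤-trans (proj₂ P-geodesic _ (reverse w₀ ++ʷ w_d)) (+-mono-≤ k₀≤e k_d≤e)

  hub-central : ∀ {c} → Hub c → Central T c
  hub-central {c} c-hub = R , (covered , farthest c-hub) , λ _ _ → radius≤ecc
    where
    covered : ∀ u → ∃[ k ] (Dist T c u k × k ≤ R)
    covered u with dist-exists c u | hub-covers c-hub u
    ... | k , dist@(_ , shortest) | j , j≤R , q = k , dist , ≤-trans (shortest j q) j≤R
    farthest : ∀ {c} → Hub c → ∃[ u ] (Dist T c u R)
    farthest (inj₁ refl) = u_d , subst (Walk adj x u_d) 1+rest≡R (step xy after) , λ _ → x→u_d
    farthest (inj₂ (ε≡1 , refl)) =
      u₀ , subst (Walk adj y u₀) (cong (r +_) (sym ε≡1)) (reverse (before ++ʷ step xy (stop y))) ,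
      λ m q → subst (_≤ m) (trans (+-comm 1 r) (cong (r +_) (sym ε≡1))) (y→u₀ q)

  hubEdge : BoolRel
  hubEdge u v = does (ε ≟ℕ 1) ∧ edge x y u v

  hubEdge⁻ : ∀ {a b} → hubEdge a b ≡ true → ε ≡ 1 × ((x ≡ a × y ≡ b) ⊎ (x ≡ b × y ≡ a))
  hubEdge⁻ {a} {b} h = let odd , xy-ab = ∧-true⁻ {does (ε ≟ℕ 1)} h
                       in from-does (ε ≟ℕ 1) odd , edge⁻ {x} {y} {a} {b} xy-ab

  hubEdge⇒Hub : ∀ {a b} → hubEdge a b ≡ true → Hub a
  hubEdge⇒Hub h with hubEdge⁻ h
  ... | _   , inj₁ (refl , _) = inj₁ refl
  ... | ε≡1 , inj₂ (_ , refl) = inj₂ (ε≡1 , refl)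

  hubEdge-yx : ε ≡ 1 → hubEdge y x ≡ true
  hubEdge-yx ε≡1 = ∧-true⁺ (dec-true (ε ≟ℕ 1) ε≡1) (trans (edge-sym x y y x) (edge-here x y))

  hubEdge-sym : ∀ u v → hubEdge u v ≡ hubEdge v u
  hubEdge-sym u v = cong (does (ε ≟ℕ 1) ∧_) (edge-sym x y u v)

  edgeCount-hubEdge : edgeCount hubEdge ≡ ε
  edgeCount-hubEdge with ε≡0⊎ε≡1
  ... | inj₁ ε≡0 = trans (edgeCount-empty λ _ _ h → 0≢1 (trans (sym ε≡0) (proj₁ (hubEdge⁻ h)))) (sym ε≡0)
    where
    0≢1 : 0 ≢ 1
    0≢1 ()
  ... | inj₂ ε≡1 =
    trans (edgeCount-cong {hubEdge} {edge x y} λ u v → cong (_∧ edge x y u v) (dec-true (ε ≟ℕ 1) ε≡1))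
          (trans (edgeCount-edge (adj⇒≢ xy)) (sym ε≡1))

  pathEdges : List (Fin n) → BoolRel
  pathEdges L = ⋃ᵉ L (edgesOf ∘ path ∘ hubPath)

  steinerEdges : List (Fin n) → BoolRel
  steinerEdges L = hubEdge ∪ᵉ pathEdges L

  module _ (L : List (Fin n)) where
    open Walks (steinerEdges L) using () renaming (_++ʷ_ to _++ˢ_)
    open RetypeWalks {n} {adj} {steinerEdges L}

    steinerEdges-sym : ∀ u v → steinerEdges L u v ≡ steinerEdges L v u
    steinerEdges-sym u v = cong₂ _∨_ (hubEdge-sym u v) (⋃ᵉ-sym L (λ s → edgesOf-sym (path (hubPath s))) u v)

    steinerEdges⊆adj : steinerEdges L ⊆ᵉ adj
    steinerEdges⊆adj a b h with ∨-true⁻ {hubEdge a b} h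
    ... | inj₁ hub-ab with hubEdge⁻ hub-ab
    ...   | _ , inj₁ (refl , refl) = xy
    ...   | _ , inj₂ (refl , refl) = yx
    steinerEdges⊆adj a b h | inj₂ path-ab with ⋃ᵉ⁻ L path-ab
    ...   | s , _ , ab = edgesOf⇒adj (path (hubPath s)) a b ab

    hub→x : ∀ {c} → Hub c → ∃[ k ] Walk (steinerEdges L) c x k
    hub→x (inj₁ refl)         = 0 , stop x
    hub→x (inj₂ (ε≡1 , refl)) = 1 , step (∨-trueˡ (hubEdge-yx ε≡1)) (stop x)

    onPath→x : ∀ {s v} → s ∈ˡ L → v ∈ˡ verts adj (path (hubPath s)) → ∃[ k ] Walk (steinerEdges L) v x k
    onPath→x {s} s∈ v∈ =
      let _ , j , _ , (v→hub , v→hub⊆) , _ = splitAtVertex (path (hubPath s)) v∈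
          k , hub→x′ = hub→x (isHub (hubPath s))
      in j + k , retype v→hub (λ e → ∨-trueʳ {hubEdge _ _} (⋃ᵉ⁺ s∈ (edgesOf⁺ (path (hubPath s)) (inj₁ (v→hub⊆ e)))))
                 ++ˢ hub→x′

    steinerEdges→x : ∀ u v → steinerEdges L u v ≡ true → ∃[ k ] Walk (steinerEdges L) u x k
    steinerEdges→x u v h with ∨-true⁻ {hubEdge u v} h
    ... | inj₁ hub-uv  = hub→x (hubEdge⇒Hub hub-uv)
    ... | inj₂ path-uv with ⋃ᵉ⁻ L path-uv
    ...   | s , s∈ , uv = onPath→x s∈ (proj₁ (edgesOf⇒∈verts (path (hubPath s)) uv))

    steinerTree : Subtree T
    steinerTree = subtreeOf (steinerEdges L) steinerEdges-sym steinerEdges⊆adj x steinerEdges→x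

    ⊆steinerTree : ∀ {s} → s ∈ˡ L → s ∈ Subtree.W steinerTree
    ⊆steinerTree {s} s∈ = reach⇒∈support (steinerEdges L) steinerEdges-sym steinerEdges⊆adj x steinerEdges→x
                            (proj₂ (onPath→x s∈ (head∈verts (path (hubPath s)))))

    edgeCount-steinerEdges≤ : edgeCount (steinerEdges L) ≤ ε + length L * r
    edgeCount-steinerEdges≤ =
      ≤-trans (edgeCount-∪ hubEdge (pathEdges L))
              (+-mono-≤ (≤-reflexive edgeCount-hubEdge)
                        (edgeCount-⋃ᵉ≤ L λ s → ≤-trans (edgeCount-edgesOf≤ (path (hubPath s))) (len≤r (hubPath s))))

  u₀≢u_d : u₀ ≢ u_d
  u₀≢u_d refl = case ≤-trans 1≤d (proj₂ P-geodesic 0 (stop u₀)) of λ ()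

  module AtRadius (A : Subset n) (u₀∈A : u₀ ∈ A) (u_d∈A : u_d ∈ A)
    (at-radius : ∀ w → w ∈ A → DistToCenter T w r)
    (paths-disjoint : ∀ w w′ → w ∈ A → w′ ∈ A → w ≢ w′ →
      ∀ c c′ k k′ (p : Walk adj w c k) (q : Walk adj w′ c′ k′) →
      Central T c → Central T c′ → DistToCenter T w k → DistToCenter T w′ k′ →
      ¬ SharesEdge adj p q) where

    r≤toHub : ∀ {w c j} → w ∈ A → Hub c → Walk adj w c j → r ≤ j
    r≤toHub {w} {c} {j} w∈ c-hub q =
      let k , dist@(_ , shortest) = dist-exists w c
      in ≤-trans (proj₂ (at-radius w w∈) c k (hub-central c-hub) dist) (shortest j q)

    len≡r : ∀ {w} → w ∈ A → len (hubPath w) ≡ r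
    len≡r {w} w∈ = ≤-antisym (len≤r (hubPath w)) (r≤toHub w∈ (isHub (hubPath w)) (path (hubPath w)))

    source-not-hub : ∀ {w a b} → w ∈ A → EdgeIn adj (path (hubPath w)) a b → ¬ Hub a
    source-not-hub {w} w∈ ab a-hub with splitAtEdge (path (hubPath w)) ab
    ... | i , j , w→a , _ , 1+i+j≡len =
      ≤⇒≯ (r≤toHub w∈ a-hub w→a) (≤-trans (s≤s (m≤m+n i j)) (subst (_≤ r) (sym 1+i+j≡len) (len≤r (hubPath w))))

    no-shared-edge : ∀ {w w′ a b} → w ∈ A → w′ ∈ A → w ≢ w′ →
                     Uses (path (hubPath w)) a b → Uses (path (hubPath w′)) a b → ⊥
    no-shared-edge {w} {w′} w∈ w′∈ w≢w′ uses uses′ =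
      paths-disjoint w w′ w∈ w′∈ w≢w′ _ _ _ _ (path (hubPath w)) (path (hubPath w′))
        (hub-central (isHub (hubPath w))) (hub-central (isHub (hubPath w′)))
        (subst (DistToCenter T w) (sym (len≡r w∈)) (at-radius w w∈))
        (subst (DistToCenter T w′) (sym (len≡r w′∈)) (at-radius w′ w′∈))
        (Uses-shared uses uses′)

    edgeCount-steinerEdges : ∀ {L} → (∀ {s} → s ∈ˡ L → s ∈ A) → Unique L →
                             edgeCount (steinerEdges L) ≡ ε + length L * r
    edgeCount-steinerEdges {L} L⊆A unique-L =
      trans (edgeCount-∪-disjoint {hubEdge} {pathEdges L} hub#paths)
            (cong₂ _+_ edgeCount-hubEdge (edgeCount-⋃ᵉ L unique-L path-length paths#paths))
      where
      path-length : ∀ {s} → s ∈ˡ L → edgeCount (edgesOf (path (hubPath s))) ≡ r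
      path-length {s} s∈ = trans (edgeCount-edgesOf-path (path (hubPath s)) (unique (hubPath s))) (len≡r (L⊆A s∈))
      paths#paths : ∀ {s t} → s ∈ˡ L → t ∈ˡ L → s ≢ t →
                    Disjointᵉ (edgesOf (path (hubPath s))) (edgesOf (path (hubPath t)))
      paths#paths {s} {t} s∈ t∈ s≢t a b ab ab′ =
        no-shared-edge (L⊆A s∈) (L⊆A t∈) s≢t (edgesOf⁻ (path (hubPath s)) ab) (edgesOf⁻ (path (hubPath t)) ab′)
      hub#paths : Disjointᵉ hubEdge (pathEdges L)
      hub#paths a b hub-ab path-ab with ⋃ᵉ⁻ L path-ab
      ... | s , s∈ , ab with edgesOf⁻ (path (hubPath s)) ab
      ...   | inj₁ a→b = source-not-hub (L⊆A s∈) a→b (hubEdge⇒Hub hub-ab)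
      ...   | inj₂ b→a = source-not-hub (L⊆A s∈) b→a (hubEdge⇒Hub (trans (hubEdge-sym b a) hub-ab))

    -- Closing q up through the hub paths of w and w′ gives a walk from b back to a; in a tree it must
    -- use the edge ab, and every piece except q is ruled out.
    hubPath-on-every-walk : ∀ {w w′ k a b} → w ∈ A → w′ ∈ A → w ≢ w′ → (q : Walk adj w w′ k) →
                            EdgeIn adj (path (hubPath w)) a b → Uses q a b
    hubPath-on-every-walk {w} {w′} {a = a} {b} w∈ w′∈ w≢w′ q ab
      with splitAtEdge (path (hubPath w)) ab | hubLink (isHub (hubPath w)) (isHub (hubPath w′))
    ... | i , j , pre , suf , 1+i+j≡len | _ , _ , link , link-hubs =
      in-q (returnWalk-uses-edge (EdgeIn⇒E ab) (suf ++ʷ link ++ʷ reverse path′ ++ʷ reverse q ++ʷ pre))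
      where
      path′ : Walk adj w′ (hub (hubPath w′)) (len (hubPath w′))
      path′ = path (hubPath w′)
      no-shortcut : ∀ {c m} → Hub c → Walk adj w c m → m ≤ i + j → ⊥
      no-shortcut c-hub p m≤i+j = ≤⇒≯ (r≤toHub w∈ c-hub p)
        (≤-trans (s≤s m≤i+j) (subst (_≤ r) (sym 1+i+j≡len) (len≤r (hubPath w))))
      a∉suf : a ∈ˡ verts adj suf → ⊥
      a∉suf a∈ with splitAtVertex suf a∈
      ... | i′ , j′ , _ , (a→hub , _) , i′+j′≡j =
        no-shortcut (isHub (hubPath w)) (pre ++ʷ a→hub) (+-monoʳ-≤ i (subst (j′ ≤_) i′+j′≡j (m≤n+m j′ i′)))
      b∉pre : b ∈ˡ verts adj pre → ⊥
      b∉pre b∈ with splitAtVertex pre b∈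
      ... | i′ , j′ , w→b , _ , i′+j′≡i =
        no-shortcut (isHub (hubPath w)) (w→b ++ʷ suf) (+-monoˡ-≤ j (subst (i′ ≤_) i′+j′≡i (m≤m+n i′ j′)))
      in-q : Uses (suf ++ʷ link ++ʷ reverse path′ ++ʷ reverse q ++ʷ pre) a b → Uses q a b
      in-q u with Uses-++⁻ suf _ u
      ... | inj₁ in-suf = ⊥-elim (a∉suf (proj₁ (Uses⇒∈verts in-suf)))
      ... | inj₂ u₁ with Uses-++⁻ link _ u₁
      ...   | inj₁ in-link = ⊥-elim (source-not-hub w∈ ab (link-hubs in-link))
      ...   | inj₂ u₂ with Uses-++⁻ (reverse path′) _ u₂
      ...     | inj₁ in-path′ = ⊥-elim (no-shared-edge w∈ w′∈ w≢w′ (inj₁ ab) (Uses-reverse path′ in-path′))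
      ...     | inj₂ u₃ with Uses-++⁻ (reverse q) pre u₃
      ...       | inj₁ in-q′  = Uses-reverse q in-q′
      ...       | inj₂ in-pre = ⊥-elim (b∉pre (proj₂ (Uses⇒∈verts in-pre)))

    another : ∀ w → ∃[ w′ ] w′ ∈ A × w ≢ w′
    another w with w ≟ u₀
    ... | yes refl  = u_d , u_d∈A , u₀≢u_d
    ... | no w≢u₀   = u₀ , u₀∈A , w≢u₀

    module _ (H : Subtree T) (A⊆W : A ⊆ Subtree.W H) where
      open Subtree H
      open RetypeWalks {n} {F} {adj}

      toAdj : ∀ {u v k} → Walk F u v k → Walk adj u v k
      toAdj = mapWalk (F-adj _ _)

      F-uses : ∀ {u v k a b} (fq : Walk F u v k) → Uses (toAdj fq) a b → F a b ≡ true
      F-uses fq = SymmetricWalks.Uses⇒E F F-sym ∘ Uses-retype⁻ fq _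

      hubEdge-kept : ∀ {a b} → hubEdge a b ≡ true → F a b ≡ true
      hubEdge-kept hub-ab with F-conn u₀ u_d (A⊆W u₀∈A) (A⊆W u_d∈A) | hubEdge⁻ hub-ab
      ... | _ , fq | _ , inj₁ (refl , refl) = F-uses fq (crossing (toAdj fq))
      ... | _ , fq | _ , inj₂ (refl , refl) = F-uses fq (Sum.swap (crossing (toAdj fq)))

      hubPath-kept : ∀ {s a b} → s ∈ A → Uses (path (hubPath s)) a b → F a b ≡ true
      hubPath-kept {s} s∈A uses with another s
      ... | w′ , w′∈A , s≢w′ with F-conn s w′ (A⊆W s∈A) (A⊆W w′∈A)
      ...   | _ , fq with uses
      ...     | inj₁ a→b = F-uses fq (hubPath-on-every-walk s∈A w′∈A s≢w′ (toAdj fq) a→b)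
      ...     | inj₂ b→a = F-uses fq (Sum.swap (hubPath-on-every-walk s∈A w′∈A s≢w′ (toAdj fq) b→a))

      steinerEdges-minimal : steinerEdges (elements A) ⊆ᵉ F
      steinerEdges-minimal a b h with ∨-true⁻ {hubEdge a b} h
      ... | inj₁ hub-ab  = hubEdge-kept hub-ab
      ... | inj₂ path-ab =
        let s , s∈ , ab = ⋃ᵉ⁻ (elements A) path-ab in hubPath-kept (∈-elements⁻ A s∈) (edgesOf⁻ (path (hubPath s)) ab)

lemma4p2 : ∀ {n} (T : Tree n) (d : ℕ) → 1 ≤ d →
    (u₀ u_d : Fin n) (P : Walk (Tree.adj T) u₀ u_d d) → IsDiametricalPath T P →
    (A : Subset n) → MaximalAdmissible T d u₀ u_d A →
    (2 ≤ ∣ A ∣ × ∣ A ∣ ≤ ∣ L T ∣ × ∃[ k ] (SteinerDist T A k × Sd T ∣ A ∣ k))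
lemma4p2 T d 1≤d u₀ u_d P (diameter , _ , P-geodesic) A ((A⊆L , (u₀∈A , u_d∈A) , at-radius , disjoint) , _) =
  two-elements u₀≢u_d u₀∈A u_d∈A , p⊆q⇒∣p∣≤∣q∣ A⊆L ,
  edgeCount (steinerEdges (elements A)) , steinerDist-A , (A , refl , steinerDist-A) , largest
  where
  open Diametral T P diameter P-geodesic 1≤d
  open AtRadius A u₀∈A u_d∈A at-radius disjoint
  open EdgeRelations using (edgeCount-mono)
  steinerDist-A : SteinerDist T A (edgeCount (steinerEdges (elements A)))
  steinerDist-A = (steinerTree (elements A) , ⊆steinerTree (elements A) ∘ ∈-elements⁺ , refl)
                , λ H A⊆W → edgeCount-mono (steinerEdges-minimal H A⊆W)
  largest : ∀ S k → ∣ S ∣ ≡ ∣ A ∣ → SteinerDist T S k → k ≤ edgeCount (steinerEdges (elements A))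
  largest S k ∣S∣≡∣A∣ (_ , k-least) = begin
    k                                     ≤⟨ k-least (steinerTree (elements S)) (⊆steinerTree (elements S) ∘ ∈-elements⁺) ⟩
    edgeCount (steinerEdges (elements S)) ≤⟨ edgeCount-steinerEdges≤ (elements S) ⟩
    ε + length (elements S) * r           ≡⟨ cong (λ m → ε + m * r) same-length ⟩
    ε + length (elements A) * r           ≡⟨ edgeCount-steinerEdges (∈-elements⁻ A) (elements-unique A) ⟨
    edgeCount (steinerEdges (elements A)) ∎
    where
    open ≤-Reasoning
    same-length : length (elements S) ≡ length (elements A)
    same-length = trans (length-elements S) (trans ∣S∣≡∣A∣ (sym (length-elements A)))
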